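{- Let $\mathbb{F}$ be a field, let $n\geq 2$, let $y\in\mathbb{F}$ and let $x\in\mathbb{F}^{\times}$ with $x\notin\{1,-1\}$. Put $z=\frac{yx}{x^2-1}$. Then, as $n\times n$ matrices over $\mathbb{F}$, $$Q(y,x)=P_1(z)\,D(x^2)\,P_1(-z).$$
   Context: All matrices are $n\times n$ with indices $1\le i,j\le n$, and the convention $0^0=1$ is used. For $w\in\mathbb{F}$, the generalized Pascal matrix of the first kind $P_1(w)$ has $(i,j)$ entry $w^{j-i}\binom{j-1}{i-1}$ if $j\geq i$ and $0$ otherwise. For $y\in\mathbb{F}$, $x\in\mathbb{F}^{\times}$, the Zhang–Liu matrix $Q(y,x)$ has $(i,j)$ entry $y^{j-i}x^{j+i-2}\binom{j-1}{i-1}$ if $j\geq i$ and $0$ otherwise. For $\alpha\in\mathbb{F}$, $D(\alpha)$ is the diagonal matrix with diagonal entries $D(\alpha)_{i,i}=\alpha^{i-1}$. -}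

module Defs where

open import Level using (_⊔_) renaming (suc to lsuc)
open import Algebra.Bundles using (CommutativeRing)
open import Data.Nat as ℕ using (ℕ; zero; suc; _∸_; _≤?_)
open import Data.Nat.Combinatorics using (_C_)
open import Data.Fin using (Fin; toℕ)
open import Relation.Nullary using (¬_; yes; no)
open import Data.Product using (∃)

record Field c ℓ : Set (lsuc (c ⊔ ℓ)) where
  field
    commutativeRing : CommutativeRing c ℓ
  open CommutativeRing commutativeRing public
  field
    0≉1     : ¬ (0# ≈ 1#)
    inverse : ∀ a → ¬ (a ≈ 0#) → ∃ λ b → a * b ≈ 1#

module FieldMatrices {c ℓ} (F : Field c ℓ) where
  open Field F

  infixr 8 _^_
  _^_ : Carrier → ℕ → Carrier
  a ^ zero  = 1#
  a ^ suc k = a * (a ^ k)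

  fromℕ : ℕ → Carrier
  fromℕ zero    = 0#
  fromℕ (suc k) = 1# + fromℕ k

  -- n × n matrices, indexed 0 .. n-1 (index i here corresponds to i+1 in the paper)
  Matrix : ℕ → Set c
  Matrix n = Fin n → Fin n → Carrier

  ∑ : ∀ {n} → (Fin n → Carrier) → Carrier
  ∑ {zero}  f = 0#
  ∑ {suc n} f = f Fin.zero + ∑ (λ i → f (Fin.suc i))

  _⊗_ : ∀ {n} → Matrix n → Matrix n → Matrix n
  (A ⊗ B) i j = ∑ (λ k → A i k * B k j)

  _≋_ : ∀ {n} → Matrix n → Matrix n → Set ℓ
  A ≋ B = ∀ i j → A i j ≈ B i j

  -- Generalized Pascal matrix of the first kind:
  -- P₁(w)_{ij} = w^{j-i} C(j-1,i-1) if j ≥ i, else 0  (1-based);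
  -- with 0-based indices: w^{j-i} C(j,i).
  P₁ : ∀ {n} → Carrier → Matrix n
  P₁ w i j with toℕ i ≤? toℕ j
  ... | yes _ = (w ^ (toℕ j ∸ toℕ i)) * fromℕ (toℕ j C toℕ i)
  ... | no  _ = 0#

  -- Zhang–Liu matrix: Q(y,x)_{ij} = y^{j-i} x^{j+i-2} C(j-1,i-1) if j ≥ i, else 0
  -- (1-based); 0-based: y^{j-i} x^{j+i} C(j,i).
  Q : ∀ {n} → Carrier → Carrier → Matrix n
  Q y x i j with toℕ i ≤? toℕ j
  ... | yes _ = ((y ^ (toℕ j ∸ toℕ i)) * (x ^ (toℕ j ℕ.+ toℕ i))) * fromℕ (toℕ j C toℕ i)
  ... | no  _ = 0#

  -- D(α)_{ii} = α^{i-1} (1-based), i.e. α^i 0-based; off-diagonal 0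
  D : ∀ {n} → Carrier → Matrix n
  D α i j with toℕ i ℕ.≟ toℕ j
  ... | yes _ = α ^ toℕ i
  ... | no  _ = 0#

module Submission where

-- Write  pw w i j = w^(j-i) C(j,i)  for the (0-based) entries of P₁(w)
-- (this vanishes for i > j, so it agrees with P₁ everywhere).  The proof
-- rests on three facts about Pascal matrices, valid in any field:
--   (1) additivity   P₁(u) P₁(v) = P₁(u+v),  a Vandermonde-type identity
--       proved by induction on the column index from Pascal's rule in the
--       form  pw w (i+1) (j+1) = pw w i j + w · pw w (i+1) j ;
--   (2) commutation  P₁(z) D(a) = D(a) P₁(za),  since z^(k-i) a^k = a^i (za)^(k-i);
--   (3) scaling      Q(y,x) = D(x²) P₁(yx),  since y^(j-i) x^(j+i) = x^(2i) (yx)^(j-i).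
-- Then  P₁(z) D(x²) P₁(-z) = D(x²) P₁(zx²) P₁(-z) = D(x²) P₁(z(x²-1)) = D(x²) P₁(yx)
-- = Q(y,x).

open import Defs
open import Level using (Level)
open import Data.Nat using (ℕ; zero; suc; _∸_; _≤_; _<_; _≤?_; _≟_; z≤n; s≤s)
import Data.Nat as ℕ
open import Data.Nat.Properties
  using (≰⇒>; +-∸-assoc; m∸n+n≡m; m+[n∸m]≡n; n<1+n; suc-injective)
open import Data.Nat.Combinatorics using (_C_; k>n⇒nCk≡0; nCk+nC[k+1]≡[n+1]C[k+1])
open import Data.Fin using (Fin; toℕ) renaming (zero to fzero; suc to fsuc)
open import Data.Fin.Properties using (toℕ<n)
open import Data.Empty using (⊥-elim)
open import Relation.Nullary using (¬_; yes; no)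
import Relation.Binary.PropositionalEquality as ≡

module PascalFactorisation {c ℓ} (F : Field c ℓ) where
  open Field F
  open FieldMatrices F
  open import Relation.Binary.Reasoning.Setoid setoid
  open import Algebra.Solver.Ring.NaturalCoefficients.Default commutativeSemiring
  open import Algebra.Properties.Ring ring using (-1*x≈-x)

  ^-cong : ∀ m {u v} → u ≈ v → u ^ m ≈ v ^ m
  ^-cong zero    u≈v = refl
  ^-cong (suc m) u≈v = *-cong u≈v (^-cong m u≈v)

  ^-+ : ∀ u m n → u ^ (m ℕ.+ n) ≈ u ^ m * u ^ n
  ^-+ u zero    n = sym (*-identityˡ _)
  ^-+ u (suc m) n = trans (*-congˡ (^-+ u m n)) (sym (*-assoc _ _ _))

  ^-distrib-* : ∀ u v m → (u * v) ^ m ≈ u ^ m * v ^ m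
  ^-distrib-* u v zero    = sym (*-identityʳ 1#)
  ^-distrib-* u v (suc m) = trans (*-congˡ (^-distrib-* u v m))
    (solve 4 (λ u v p q → (u :* v) :* (p :* q) := (u :* p) :* (v :* q)) refl u v (u ^ m) (v ^ m))

  fromℕ-+ : ∀ m n → fromℕ (m ℕ.+ n) ≈ fromℕ m + fromℕ n
  fromℕ-+ zero    n = sym (+-identityˡ _)
  fromℕ-+ (suc m) n = trans (+-congˡ (fromℕ-+ m n)) (sym (+-assoc _ _ _))

  C-vanishes : ∀ {m k} → m < k → fromℕ (m C k) ≈ 0#
  C-vanishes m<k = reflexive (≡.cong fromℕ (k>n⇒nCk≡0 m<k))

  C-pascal : ∀ m k → fromℕ (suc m C suc k) ≈ fromℕ (m C k) + fromℕ (m C suc k)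
  C-pascal m k = trans (reflexive (≡.cong fromℕ (≡.sym (nCk+nC[k+1]≡[n+1]C[k+1] m k))))
                       (fromℕ-+ (m C k) (m C suc k))

  pw : Carrier → ℕ → ℕ → Carrier
  pw w i j = w ^ (j ∸ i) * fromℕ (j C i)

  pw-below : ∀ w {i j} → j < i → pw w i j ≈ 0#
  pw-below w j<i = trans (*-congˡ (C-vanishes j<i)) (zeroʳ _)

  above-diagonal : ∀ i j {l r : Carrier} → (i ≤ j → l ≈ r) →
    (j < i → l ≈ 0#) → (j < i → r ≈ 0#) → l ≈ r
  above-diagonal i j on off₁ off₂ with i ≤? j
  ... | yes i≤j = on i≤j
  ... | no  i≰j = trans (off₁ (≰⇒> i≰j)) (sym (off₂ (≰⇒> i≰j)))

  pw-step : ∀ w i j → pw w (suc i) (suc j) ≈ pw w i j + w * pw w (suc i) j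
  pw-step w i j = begin
    w ^ (j ∸ i) * fromℕ (suc j C suc i)
      ≈⟨ *-congˡ (C-pascal j i) ⟩
    w ^ (j ∸ i) * (fromℕ (j C i) + fromℕ (j C suc i))
      ≈⟨ distribˡ _ _ _ ⟩
    pw w i j + w ^ (j ∸ i) * fromℕ (j C suc i)
      ≈⟨ +-congˡ shifted ⟩
    pw w i j + w * pw w (suc i) j ∎
    where
    shifted : w ^ (j ∸ i) * fromℕ (j C suc i) ≈ w * pw w (suc i) j
    shifted = above-diagonal (suc i) j
      (λ i<j → trans (*-congʳ (reflexive (≡.cong (w ^_) (+-∸-assoc 1 i<j)))) (*-assoc _ _ _))
      (λ j≤i → trans (*-congˡ (C-vanishes j≤i)) (zeroʳ _))
      (λ j≤i → trans (*-congˡ (pw-below w j≤i)) (zeroʳ _))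

  pw-step₀ : ∀ w j → pw w 0 (suc j) ≈ w * pw w 0 j
  pw-step₀ w j = *-assoc _ _ _

  pw-column₀ : ∀ u v i → pw u i 0 ≈ pw v i 0
  pw-column₀ u v zero    = refl
  pw-column₀ u v (suc i) = trans (pw-below u {suc i} (s≤s z≤n)) (sym (pw-below v {suc i} (s≤s z≤n)))

  sumℕ : ℕ → (ℕ → Carrier) → Carrier
  sumℕ zero    f = 0#
  sumℕ (suc n) f = f 0 + sumℕ n (λ k → f (suc k))

  sumℕ-cong : ∀ n {f g : ℕ → Carrier} → (∀ k → f k ≈ g k) → sumℕ n f ≈ sumℕ n g
  sumℕ-cong zero    f≈g = refl
  sumℕ-cong (suc n) f≈g = +-cong (f≈g 0) (sumℕ-cong n (λ k → f≈g (suc k)))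

  sumℕ-+ : ∀ n f g → sumℕ n (λ k → f k + g k) ≈ sumℕ n f + sumℕ n g
  sumℕ-+ zero    f g = sym (+-identityˡ 0#)
  sumℕ-+ (suc n) f g = trans (+-congˡ (sumℕ-+ n _ _))
    (solve 4 (λ a b p q → (a :+ b) :+ (p :+ q) := (a :+ p) :+ (b :+ q)) refl _ _ _ _)

  sumℕ-*ˡ : ∀ n a f → sumℕ n (λ k → a * f k) ≈ a * sumℕ n f
  sumℕ-*ˡ zero    a f = sym (zeroʳ a)
  sumℕ-*ˡ (suc n) a f = trans (+-congˡ (sumℕ-*ˡ n a _)) (sym (distribˡ a _ _))

  sumℕ-zero : ∀ n f → (∀ k → f k ≈ 0#) → sumℕ n f ≈ 0#
  sumℕ-zero zero    f f≈0 = refl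
  sumℕ-zero (suc n) f f≈0 = trans (+-cong (f≈0 0) (sumℕ-zero n _ (λ k → f≈0 (suc k)))) (+-identityˡ 0#)

  sumℕ-truncate : ∀ m d f → (∀ k → m ≤ k → f k ≈ 0#) → sumℕ (m ℕ.+ d) f ≈ sumℕ m f
  sumℕ-truncate zero    d f tail≈0 = sumℕ-zero d f (λ k → tail≈0 k z≤n)
  sumℕ-truncate (suc m) d f tail≈0 = +-congˡ (sumℕ-truncate m d _ (λ k m≤k → tail≈0 (suc k) (s≤s m≤k)))

  sumℕ-drop-last : ∀ n f → f n ≈ 0# → sumℕ (suc n) f ≈ sumℕ n f
  sumℕ-drop-last zero    f fn≈0 = trans (+-identityʳ _) fn≈0
  sumℕ-drop-last (suc n) f fn≈0 = +-congˡ (sumℕ-drop-last n _ fn≈0)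

  ∑-cong : ∀ {n} {f g : Fin n → Carrier} → (∀ i → f i ≈ g i) → ∑ f ≈ ∑ g
  ∑-cong {zero}  f≈g = refl
  ∑-cong {suc n} f≈g = +-cong (f≈g fzero) (∑-cong (λ i → f≈g (fsuc i)))

  ∑-*ˡ : ∀ {n} a (f : Fin n → Carrier) → ∑ (λ k → a * f k) ≈ a * ∑ f
  ∑-*ˡ {zero}  a f = sym (zeroʳ a)
  ∑-*ˡ {suc n} a f = trans (+-congˡ (∑-*ˡ a (λ i → f (fsuc i)))) (sym (distribˡ a _ _))

  ∑-as-sumℕ : ∀ n (g : ℕ → Carrier) → ∑ {n} (λ k → g (toℕ k)) ≈ sumℕ n g
  ∑-as-sumℕ zero    g = refl
  ∑-as-sumℕ (suc n) g = +-congˡ (∑-as-sumℕ n (λ k → g (suc k)))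

  ∑-single : ∀ {n} (g : Fin n → Carrier) (k : Fin n) →
    (∀ l → toℕ l ≡.≢ toℕ k → g l ≈ 0#) → ∑ g ≈ g k
  ∑-single g fzero    off≈0 = trans (+-congˡ (∑-zero (λ l → off≈0 (fsuc l) (λ ())))) (+-identityʳ _)
    where
    ∑-zero : ∀ {n} {h : Fin n → Carrier} → (∀ l → h l ≈ 0#) → ∑ h ≈ 0#
    ∑-zero {zero}  h≈0 = refl
    ∑-zero {suc n} h≈0 = trans (+-cong (h≈0 fzero) (∑-zero (λ l → h≈0 (fsuc l)))) (+-identityˡ 0#)
  ∑-single g (fsuc k) off≈0 = trans (+-congʳ (off≈0 fzero (λ ()))) (trans (+-identityˡ _)
    (∑-single (λ l → g (fsuc l)) k (λ l l≢k → off≈0 (fsuc l) (λ e → l≢k (suc-injective e)))))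

  P₁-entry : ∀ {n} w (i j : Fin n) → P₁ w i j ≈ pw w (toℕ i) (toℕ j)
  P₁-entry w i j with toℕ i ≤? toℕ j
  ... | yes _   = refl
  ... | no  i≰j = sym (pw-below w (≰⇒> i≰j))

  Q-entry : ∀ {n} y x (i j : Fin n) →
    Q y x i j ≈ (y ^ (toℕ j ∸ toℕ i) * x ^ (toℕ j ℕ.+ toℕ i)) * fromℕ (toℕ j C toℕ i)
  Q-entry y x i j with toℕ i ≤? toℕ j
  ... | yes _   = refl
  ... | no  i≰j = sym (trans (*-congˡ (C-vanishes (≰⇒> i≰j))) (zeroʳ _))

  ⊗-D : ∀ {n} (M : Matrix n) a (i k : Fin n) → (M ⊗ D a) i k ≈ M i k * a ^ toℕ k
  ⊗-D M a i k = trans (∑-single _ k (λ l l≢k → trans (*-congˡ (D-off l l≢k)) (zeroʳ _)))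
                      (*-congˡ D-diag)
    where
    D-off : ∀ l → toℕ l ≡.≢ toℕ k → D a l k ≈ 0#
    D-off l l≢k with toℕ l ≟ toℕ k
    ... | yes l≡k = ⊥-elim (l≢k l≡k)
    ... | no  _   = refl
    D-diag : D a k k ≈ a ^ toℕ k
    D-diag with toℕ k ≟ toℕ k
    ... | yes _   = refl
    ... | no  k≢k = ⊥-elim (k≢k ≡.refl)

  -- With  S J I = Σ_{k ≤ J} pw u I k · pw v k J  (the
  -- (I,J) entry of P₁(u)P₁(v)), Pascal's rule on the columns of P₁(v) gives
  -- S (J+1) I = v · S J I + Σ_{m ≤ J} pw u I (m+1) · pw v m J,  and Pascal's rule
  -- on the rows of P₁(u) evaluates the second sum.
  module Additivity (u v : Carrier) where

    S : ℕ → ℕ → Carrier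
    S J I = sumℕ (suc J) (λ k → pw u I k * pw v k J)

    S-step : ∀ J I → S (suc J) I ≈ v * S J I + sumℕ (suc J) (λ m → pw u I (suc m) * pw v m J)
    S-step J I = begin
      h 0 + sumℕ (suc J) (λ m → h (suc m))
        ≈⟨ +-cong first-term (sumℕ-cong (suc J) later-term) ⟩
      v * g 0 + sumℕ (suc J) (λ m → shift m + v * g (suc m))
        ≈⟨ +-congˡ (trans (sumℕ-+ (suc J) shift (λ m → v * g (suc m))) (+-congˡ (sumℕ-*ˡ (suc J) v (λ m → g (suc m))))) ⟩
      v * g 0 + (Shift + v * sumℕ (suc J) (λ m → g (suc m)))
        ≈⟨ solve 4 (λ v p q r → v :* p :+ (q :+ v :* r) := v :* (p :+ r) :+ q) refl v _ _ _ ⟩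
      v * sumℕ (suc (suc J)) g + Shift
        ≈⟨ +-congʳ (*-congˡ (sumℕ-drop-last (suc J) g (trans (*-congˡ (pw-below v (n<1+n J))) (zeroʳ _)))) ⟩
      v * S J I + Shift ∎
      where
      h : ℕ → Carrier
      h k = pw u I k * pw v k (suc J)
      g : ℕ → Carrier
      g k = pw u I k * pw v k J
      shift : ℕ → Carrier
      shift m = pw u I (suc m) * pw v m J
      Shift : Carrier
      Shift = sumℕ (suc J) shift
      first-term : h 0 ≈ v * g 0
      first-term = trans (*-congˡ (pw-step₀ v J))
        (solve 3 (λ p v q → p :* (v :* q) := v :* (p :* q)) refl (pw u I 0) v (pw v 0 J))
      later-term : ∀ m → h (suc m) ≈ shift m + v * g (suc m)
      later-term m = trans (*-congˡ (pw-step v m J))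
        (solve 4 (λ v p q r → p :* (q :+ v :* r) := p :* q :+ v :* (p :* r)) refl
          v (pw u I (suc m)) (pw v m J) (pw v (suc m) J))

    S-pascal : ∀ J I → S J I ≈ pw (u + v) I J
    S-pascal zero I = begin
      pw u I 0 * pw v 0 0 + 0#      ≈⟨ +-identityʳ _ ⟩
      pw u I 0 * (1# * fromℕ 1)     ≈⟨ *-congˡ (trans (*-identityˡ _) (+-identityʳ 1#)) ⟩
      pw u I 0 * 1#                 ≈⟨ *-identityʳ _ ⟩
      pw u I 0                      ≈⟨ pw-column₀ u (u + v) I ⟩
      pw (u + v) I 0 ∎
    S-pascal (suc J) zero = begin
      S (suc J) 0
        ≈⟨ S-step J 0 ⟩
      v * S J 0 + sumℕ (suc J) (λ m → pw u 0 (suc m) * pw v m J)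
        ≈⟨ +-congˡ (trans (sumℕ-cong (suc J) (λ m → trans (*-congʳ (pw-step₀ u m)) (*-assoc u (pw u 0 m) (pw v m J))))
                          (sumℕ-*ˡ (suc J) u (λ m → pw u 0 m * pw v m J))) ⟩
      v * S J 0 + u * S J 0
        ≈⟨ sym (distribʳ _ _ _) ⟩
      (v + u) * S J 0
        ≈⟨ *-cong (+-comm v u) (S-pascal J 0) ⟩
      (u + v) * pw (u + v) 0 J
        ≈⟨ sym (pw-step₀ (u + v) J) ⟩
      pw (u + v) 0 (suc J) ∎
    S-pascal (suc J) (suc I) = begin
      S (suc J) (suc I)
        ≈⟨ S-step J (suc I) ⟩
      v * S J (suc I) + sumℕ (suc J) (λ m → pw u (suc I) (suc m) * pw v m J)
        ≈⟨ +-congˡ (trans (sumℕ-cong (suc J) (λ m → trans (*-congʳ (pw-step u I m)) (expand (pw u I m) (pw u (suc I) m) (pw v m J))))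
                          (trans (sumℕ-+ (suc J) (λ m → pw u I m * pw v m J) (λ m → u * (pw u (suc I) m * pw v m J)))
                                 (+-congˡ (sumℕ-*ˡ (suc J) u (λ m → pw u (suc I) m * pw v m J))))) ⟩
      v * S J (suc I) + (S J I + u * S J (suc I))
        ≈⟨ solve 4 (λ u v p q → v :* q :+ (p :+ u :* q) := p :+ (u :+ v) :* q) refl u v _ _ ⟩
      S J I + (u + v) * S J (suc I)
        ≈⟨ +-cong (S-pascal J I) (*-congˡ (S-pascal J (suc I))) ⟩
      pw (u + v) I J + (u + v) * pw (u + v) (suc I) J
        ≈⟨ sym (pw-step (u + v) I J) ⟩
      pw (u + v) (suc I) (suc J) ∎
      where
      expand : ∀ p q r → (p + u * q) * r ≈ p * r + u * (q * r)
      expand = solve 4 (λ u p q r → (p :+ u :* q) :* r := p :* r :+ u :* (q :* r)) refl u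

  P₁-additive : ∀ {n} u v (i j : Fin n) → (P₁ u ⊗ P₁ v) i j ≈ P₁ (u + v) i j
  P₁-additive {n} u v i j = begin
    (P₁ u ⊗ P₁ v) i j
      ≈⟨ ∑-cong (λ k → *-cong (P₁-entry u i k) (P₁-entry v k j)) ⟩
    ∑ {n} (λ k → term (toℕ k))
      ≈⟨ ∑-as-sumℕ n term ⟩
    sumℕ n term
      ≈⟨ reflexive (≡.cong (λ m → sumℕ m term) (≡.sym (m+[n∸m]≡n (toℕ<n j)))) ⟩
    sumℕ (suc J ℕ.+ (n ∸ suc J)) term
      ≈⟨ sumℕ-truncate (suc J) (n ∸ suc J) term (λ k J<k → trans (*-congˡ (pw-below v J<k)) (zeroʳ _)) ⟩
    S J I
      ≈⟨ S-pascal J I ⟩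
    pw (u + v) I J
      ≈⟨ sym (P₁-entry (u + v) i j) ⟩
    P₁ (u + v) i j ∎
    where
    open Additivity u v
    I J : ℕ
    I = toℕ i
    J = toℕ j
    term : ℕ → Carrier
    term k = pw u I k * pw v k J

  pw-scale : ∀ z a i k → pw z i k * a ^ k ≈ a ^ i * pw (z * a) i k
  pw-scale z a i k = above-diagonal i k on-diagonal
    (λ k<i → trans (*-congʳ (pw-below z k<i)) (zeroˡ _))
    (λ k<i → trans (*-congˡ (pw-below (z * a) k<i)) (zeroʳ _))
    where
    on-diagonal : i ≤ k → pw z i k * a ^ k ≈ a ^ i * pw (z * a) i k
    on-diagonal i≤k = begin
      (z ^ (k ∸ i) * fromℕ (k C i)) * a ^ k
        ≈⟨ *-congˡ (trans (reflexive (≡.cong (a ^_) (≡.sym (m∸n+n≡m i≤k)))) (^-+ a (k ∸ i) i)) ⟩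
      (z ^ (k ∸ i) * fromℕ (k C i)) * (a ^ (k ∸ i) * a ^ i)
        ≈⟨ solve 4 (λ p c q r → (p :* c) :* (q :* r) := r :* ((p :* q) :* c)) refl _ _ _ _ ⟩
      a ^ i * ((z ^ (k ∸ i) * a ^ (k ∸ i)) * fromℕ (k C i))
        ≈⟨ *-congˡ (*-congʳ (sym (^-distrib-* z a (k ∸ i)))) ⟩
      a ^ i * pw (z * a) i k ∎

  P₁-D-⊗ : ∀ {n} z a (M : Matrix n) (i j : Fin n) →
    ((P₁ z ⊗ D a) ⊗ M) i j ≈ a ^ toℕ i * (P₁ (z * a) ⊗ M) i j
  P₁-D-⊗ z a M i j = begin
    ∑ (λ k → (P₁ z ⊗ D a) i k * M k j)
      ≈⟨ ∑-cong (λ k → *-congʳ (begin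
           (P₁ z ⊗ D a) i k                         ≈⟨ ⊗-D (P₁ z) a i k ⟩
           P₁ z i k * a ^ toℕ k                     ≈⟨ *-congʳ (P₁-entry z i k) ⟩
           pw z (toℕ i) (toℕ k) * a ^ toℕ k         ≈⟨ pw-scale z a (toℕ i) (toℕ k) ⟩
           a ^ toℕ i * pw (z * a) (toℕ i) (toℕ k)   ≈⟨ *-congˡ (sym (P₁-entry (z * a) i k)) ⟩
           a ^ toℕ i * P₁ (z * a) i k ∎)) ⟩
    ∑ (λ k → (a ^ toℕ i * P₁ (z * a) i k) * M k j)
      ≈⟨ ∑-cong (λ k → *-assoc (a ^ toℕ i) (P₁ (z * a) i k) (M k j)) ⟩
    ∑ (λ k → a ^ toℕ i * (P₁ (z * a) i k * M k j))
      ≈⟨ ∑-*ˡ (a ^ toℕ i) (λ k → P₁ (z * a) i k * M k j) ⟩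
    a ^ toℕ i * (P₁ (z * a) ⊗ M) i j ∎

  Q-scaled : ∀ {n} y x (i j : Fin n) → Q y x i j ≈ (x * x) ^ toℕ i * P₁ (y * x) i j
  Q-scaled y x i j = begin
    Q y x i j
      ≈⟨ Q-entry y x i j ⟩
    (y ^ (J ∸ I) * x ^ (J ℕ.+ I)) * fromℕ (J C I)
      ≈⟨ above-diagonal I J on-diagonal
           (λ J<I → trans (*-congˡ (C-vanishes J<I)) (zeroʳ _))
           (λ J<I → trans (*-congˡ (pw-below (y * x) J<I)) (zeroʳ _)) ⟩
    (x * x) ^ I * pw (y * x) I J
      ≈⟨ *-congˡ (sym (P₁-entry (y * x) i j)) ⟩
    (x * x) ^ I * P₁ (y * x) i j ∎
    where
    I J : ℕ
    I = toℕ i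
    J = toℕ j
    on-diagonal : I ≤ J → (y ^ (J ∸ I) * x ^ (J ℕ.+ I)) * fromℕ (J C I) ≈ (x * x) ^ I * pw (y * x) I J
    on-diagonal I≤J = begin
      (y ^ (J ∸ I) * x ^ (J ℕ.+ I)) * fromℕ (J C I)
        ≈⟨ *-congʳ (*-congˡ (reflexive (≡.cong (λ m → x ^ (m ℕ.+ I)) (≡.sym (m∸n+n≡m I≤J))))) ⟩
      (y ^ (J ∸ I) * x ^ (((J ∸ I) ℕ.+ I) ℕ.+ I)) * fromℕ (J C I)
        ≈⟨ *-congʳ (*-congˡ (trans (^-+ x ((J ∸ I) ℕ.+ I) I) (*-congʳ (^-+ x (J ∸ I) I)))) ⟩
      (y ^ (J ∸ I) * ((x ^ (J ∸ I) * x ^ I) * x ^ I)) * fromℕ (J C I)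
        ≈⟨ solve 5 (λ p q r s c → (p :* ((q :* r) :* s)) :* c := (r :* s) :* ((p :* q) :* c)) refl _ _ _ _ _ ⟩
      (x ^ I * x ^ I) * ((y ^ (J ∸ I) * x ^ (J ∸ I)) * fromℕ (J C I))
        ≈⟨ *-cong (sym (^-distrib-* x x I)) (*-congʳ (sym (^-distrib-* y x (J ∸ I)))) ⟩
      (x * x) ^ I * pw (y * x) I J ∎

  exponent-sum : ∀ y x inv → (x * x - 1#) * inv ≈ 1# →
    (y * x) * inv * (x * x) + - ((y * x) * inv) ≈ y * x
  exponent-sum y x inv inverse-eq = begin
    z * (x * x) + - z
      ≈⟨ +-congˡ (sym (-1*x≈-x z)) ⟩
    z * (x * x) + - 1# * z
      ≈⟨ solve 4 (λ p i a m → p :* i :* a :+ m :* (p :* i) := p :* ((a :+ m) :* i)) refl (y * x) inv (x * x) (- 1#) ⟩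
    (y * x) * ((x * x - 1#) * inv)
      ≈⟨ *-congˡ inverse-eq ⟩
    (y * x) * 1#
      ≈⟨ *-identityʳ _ ⟩
    y * x ∎
    where
    z : Carrier
    z = (y * x) * inv

theorem1 : ∀ {c ℓ : Level} (F : Field c ℓ) → let open Field F in let open FieldMatrices F in
    (n : ℕ) → 2 ≤ n → (y x : Carrier) → ¬ (x ≈ 0#) → ¬ (x ≈ 1#) → ¬ (x ≈ - 1#) →
    (inv : Carrier) → (x * x - 1#) * inv ≈ 1# →
    Q {n} y x ≋ ((P₁ {n} ((y * x) * inv) ⊗ D {n} (x * x)) ⊗ P₁ {n} (- ((y * x) * inv)))
theorem1 F n _ y x _ _ _ inv inverse-eq i j = begin
  Q y x i j
    ≈⟨ Q-scaled y x i j ⟩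
  (x * x) ^ toℕ i * P₁ (y * x) i j
    ≈⟨ *-congˡ (sym (P₁-cong (exponent-sum y x inv inverse-eq))) ⟩
  (x * x) ^ toℕ i * P₁ (z * (x * x) + - z) i j
    ≈⟨ *-congˡ (sym (P₁-additive (z * (x * x)) (- z) i j)) ⟩
  (x * x) ^ toℕ i * (P₁ (z * (x * x)) ⊗ P₁ (- z)) i j
    ≈⟨ sym (P₁-D-⊗ z (x * x) (P₁ (- z)) i j) ⟩
  ((P₁ z ⊗ D (x * x)) ⊗ P₁ (- z)) i j ∎
  where
  open Field F
  open FieldMatrices F
  open PascalFactorisation F
  open import Relation.Binary.Reasoning.Setoid setoid
  z : Carrier
  z = (y * x) * inv
  P₁-cong : ∀ {u v} → u ≈ v → P₁ {n} u i j ≈ P₁ v i j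
  P₁-cong {u} {v} u≈v = trans (P₁-entry u i j)
    (trans (*-congʳ (^-cong (toℕ j ∸ toℕ i) u≈v)) (sym (P₁-entry v i j)))
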